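{- Let $G$ be a locally finite graph, $T$ a faithful spanning tree of $G$, and $F\subseteq E(T)$ such that every component of $T-F$ is finite. Let $k\ge0$ be an integer. If for every edge $e\in F$ the graph $G$ has at most $k$ edges between the two components of $T-e$, then every end of $G$ has degree at most $k$.
   Context: A ray is a one-way infinite path; its subrays are tails. Two rays $R_1,R_2$ of a graph $X$ are equivalent in $X$ ($R_1\approx_X R_2$) if for every finite $S\subseteq V(X)$ some component of $X-S$ contains tails of both; the classes are the ends of $X$. A subgraph $H$ of $G$ is faithful to $G$ if (1) every end of $G$ contains a ray of $H$, and (2) for any two rays $R_1,R_2$ of $H$, $R_1\approx_H R_2$ iff $R_1\approx_G R_2$. The degree of an end is the maximum number of vertex-disjoint rays in it. -}

module Defs where

open import Data.Nat using (ℕ; zero; suc; _+_; _∸_; _≤_; _<_)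
open import Data.Fin using (Fin)
open import Data.Product using (Σ; ∃; ∃-syntax; _×_; _,_)
open import Data.Sum using (_⊎_)
open import Data.Unit using (⊤)
open import Data.Empty using (⊥)
open import Data.List using (List; []; length)
open import Data.List.Membership.Propositional using (_∈_; _∉_)
open import Relation.Nullary using (¬_)
open import Relation.Binary.PropositionalEquality using (_≡_; _≢_)
open import Function.Bundles using (_⇔_)

record Graph : Set₁ where
  field
    V     : Set
    _~_   : V → V → Set
    ~-sym : ∀ {u v} → u ~ v → v ~ u
    ~-irr : ∀ {u} → ¬ (u ~ u)

module _ (G : Graph) where
  open Graph G

  -- A subgraph X of G: a vertex predicate and an edge predicate
  -- (all notions below check membership explicitly).
  record Sub : Set₁ where
    constructor sub
    field
      inV : V → Set
      adj : V → V → Set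

  open Sub

  whole : Sub
  whole = sub (λ _ → ⊤) _~_

  LocallyFinite : Set
  LocallyFinite = ∀ v → Σ (List V) λ L → ∀ w → v ~ w → w ∈ L

  data Reach (X : Sub) (S : List V) : V → V → Set where
    here : ∀ {u} → inV X u → u ∉ S → Reach X S u u
    step : ∀ {u v w} → inV X u → u ∉ S → adj X u v → Reach X S v w → Reach X S u w

  IsRay : Sub → (ℕ → V) → Set
  IsRay X f = (∀ i → inV X (f i))
            × (∀ i → adj X (f i) (f (suc i)))
            × (∀ i j → f i ≡ f j → i ≡ j)

  -- Equivalence of rays in X: for every finite S, some component of X - S
  -- contains tails of both (tails f(n+_) and g(m+_) avoid S and are joined in X - S).
  Equiv : Sub → (ℕ → V) → (ℕ → V) → Set
  Equiv X f g = ∀ (S : List V) → ∃[ n ] ∃[ m ]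
      (∀ i → f (n + i) ∉ S) × (∀ j → g (m + j) ∉ S) × Reach X S (f n) (g m)

  Faithful : Sub → Set
  Faithful H =
      (∀ f → IsRay whole f → ∃[ g ] IsRay H g × Equiv whole g f)
    × (∀ f g → IsRay H f → IsRay H g → (Equiv H f g ⇔ Equiv whole f g))

  HasCycle : Sub → Set
  HasCycle X = ∃[ n ] Σ (ℕ → V) λ c → 3 ≤ n
      × (∀ i → i < n → inV X (c i))
      × (∀ i j → i < n → j < n → c i ≡ c j → i ≡ j)
      × (∀ i → suc i < n → adj X (c i) (c (suc i)))
      × adj X (c (n ∸ 1)) (c 0)

  spanning : (V → V → Set) → Sub
  spanning TE = sub (λ _ → ⊤) TE

  SpanningTree : (V → V → Set) → Set
  SpanningTree TE =
      (∀ u v → TE u v → u ~ v)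
    × (∀ u v → TE u v → TE v u)
    × (∀ u v → Reach (spanning TE) [] u v)
    × ¬ HasCycle (spanning TE)

  minusEdges : (V → V → Set) → (V → V → Set) → Sub
  minusEdges TE F = sub (λ _ → ⊤) (λ u v → TE u v × ¬ F u v)

  minusEdge : (V → V → Set) → V → V → Sub
  minusEdge TE a b = sub (λ _ → ⊤)
    (λ u v → TE u v × ¬ ((u ≡ a × v ≡ b) ⊎ (u ≡ b × v ≡ a)))

  FiniteComponent : Sub → V → Set
  FiniteComponent X v = Σ (List V) λ L → ∀ w → Reach X [] v w → w ∈ L

  -- G has at most k edges between the component of a and the component of b
  -- in T - ab.  Each such edge is recorded once, oriented from a's side
  -- to b's side.
  AtMostCrossing : (V → V → Set) → V → V → ℕ → Set
  AtMostCrossing TE a b k = Σ (List (V × V)) λ L → length L ≤ k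
    × (∀ x y → x ~ y → Reach (minusEdge TE a b) [] a x
                     → Reach (minusEdge TE a b) [] b y → (x , y) ∈ L)

  -- Every end of G has degree at most k: no end contains k+1 vertex-disjoint rays.
  EndDegreesAtMost : ℕ → Set
  EndDegreesAtMost k = ∀ (R : ℕ → V) → IsRay whole R →
    ¬ (Σ (Fin (suc k) → ℕ → V) λ Rs →
          (∀ i → IsRay whole (Rs i))
        × (∀ i → Equiv whole (Rs i) R)
        × (∀ i j → i ≢ j → ∀ m n → Rs i m ≢ Rs j n))

-- The faithful spanning tree T contains a ray g of the end.  As the components of T - F are
-- finite, g uses edges e = g p g(p+1) of F with p arbitrarily large; take p beyond the tree
-- distances from g 0 to the first vertices of the k+1 disjoint rays.  Each of these rays then
-- starts on the side of g 0 in T - e, while, being equivalent to g, it has a tail joined in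
-- G - S to a tail of g on the far side, where S is the set of near ends of the at most k edges
-- of G crossing e.  So each ray meets S, and disjointness gives k+1 ≤ |S|.  The goal being ⊥,
-- the whole argument may use excluded middle under double negation.

module Submission where

open import Defs
open import Data.Nat using (ℕ; zero; suc; _+_; _≤_; _<_; z≤n; s≤s)
open import Data.Nat.Properties
open import Data.Nat.Induction using (<-rec)
open import Data.Fin as Fin using (Fin; toℕ)
import Data.Fin.Properties as Finₚ
open import Data.Product using (Σ; ∃₂; ∃-syntax; _×_; _,_; proj₁; proj₂)
open import Data.Sum using (_⊎_; inj₁; inj₂) renaming (map to ⊎-map)
open import Data.Unit using (tt)
open import Data.Empty using (⊥; ⊥-elim)
open import Data.List using (List; []; length; map; lookup)
open import Data.List.Properties using (length-map)
open import Data.List.Membership.Propositional using (_∈_; _∉_)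
open import Data.List.Membership.Propositional.Properties using (∈-map⁺)
open import Data.List.Relation.Unary.Any using (index)
open import Data.List.Relation.Unary.Any.Properties using (lookup-index)
open import Function using (_∘_)
open import Relation.Nullary using (¬_; yes; no)
open import Relation.Nullary.Decidable using (¬¬-excluded-middle)
open import Relation.Binary using (tri<; tri≈; tri>)
open import Relation.Binary.PropositionalEquality

¬¬-∀-Fin : ∀ n {P : Fin n → Set} → (∀ i → ¬ ¬ P i) → ¬ ¬ (∀ i → P i)
¬¬-∀-Fin zero    _   k = k (λ ())
¬¬-∀-Fin (suc n) ¬¬P k = ¬¬P Fin.zero λ P₀ →
  ¬¬-∀-Fin n (λ i → ¬¬P (Fin.suc i)) λ Pₛ →
    k λ { Fin.zero → P₀ ; (Fin.suc i) → Pₛ i }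

Fin-upper-bound : ∀ n (f : Fin n → ℕ) → ∃[ N ] (∀ i → f i ≤ N)
Fin-upper-bound zero    f = 0 , λ ()
Fin-upper-bound (suc n) f with N , f≤N ← Fin-upper-bound n (λ i → f (Fin.suc i)) =
  f Fin.zero + N , λ { Fin.zero → m≤m+n _ N ; (Fin.suc i) → ≤-trans (f≤N i) (m≤n+m N _) }

pigeonhole-∈ : ∀ {A : Set} {n} {xs : List A} (f : Fin n → A) → length xs < n
  → (∀ i → f i ∈ xs) → ∃₂ λ i j → i Fin.< j × f i ≡ f j
pigeonhole-∈ {xs = xs} f short f∈ with i , j , i<j , same ← Finₚ.pigeonhole short (λ i → index (f∈ i)) =
  i , j , i<j , trans (lookup-index (f∈ i)) (trans (cong (lookup xs) same) (sym (lookup-index (f∈ j))))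

disjoint-hitting-list-length : ∀ {A : Set} {n} (Rs : Fin n → ℕ → A) {S : List A}
  → (∀ i j → i ≢ j → ∀ m m′ → Rs i m ≢ Rs j m′)
  → (∀ i → ∃[ m ] Rs i m ∈ S) → n ≤ length S
disjoint-hitting-list-length Rs disjoint hits = ≮⇒≥ λ short →
  let i , j , i<j , same = pigeonhole-∈ (λ i → Rs i (proj₁ (hits i))) short (λ i → proj₂ (hits i))
  in disjoint i j (Finₚ.<⇒≢ i<j) _ _ same

module _ {G : Graph} where
  open Graph G

  Reach-length : ∀ {X S u v} → Reach G X S u v → ℕ
  Reach-length (here _ _)     = 0
  Reach-length (step _ _ _ r) = suc (Reach-length r)

  Reach-snoc : ∀ {X S u v w} → Reach G X S u v → Sub.inV X w → w ∉ S → Sub.adj X v w → Reach G X S u w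
  Reach-snoc (here u∈ u∉) w∈ w∉ vw       = step u∈ u∉ vw (here w∈ w∉)
  Reach-snoc (step u∈ u∉ uu′ r) w∈ w∉ vw = step u∈ u∉ uu′ (Reach-snoc r w∈ w∉ vw)

  infixr 5 _++_
  _++_ : ∀ {X S u v w} → Reach G X S u v → Reach G X S v w → Reach G X S u w
  here _ _         ++ r′ = r′
  step u∈ u∉ uu′ r ++ r′ = step u∈ u∉ uu′ (r ++ r′)

  Reach-reverse : ∀ {X S u v} → (∀ {x y} → Sub.adj X x y → Sub.adj X y x) → Reach G X S u v → Reach G X S v u
  Reach-reverse sym (here u∈ u∉)       = here u∈ u∉
  Reach-reverse sym (step u∈ u∉ uu′ r) = Reach-snoc (Reach-reverse sym r) u∈ u∉ (sym uu′)

  Reach-prefix : ∀ {X S} (f : ℕ → V) d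
    → (∀ i → i ≤ d → Sub.inV X (f i)) → (∀ i → i ≤ d → f i ∉ S)
    → (∀ i → i < d → Sub.adj X (f i) (f (suc i)))
    → Reach G X S (f 0) (f d)
  Reach-prefix f zero    f∈ f∉ _  = here (f∈ 0 z≤n) (f∉ 0 z≤n)
  Reach-prefix f (suc d) f∈ f∉ ff =
    Reach-snoc (Reach-prefix f d (λ i → f∈ i ∘ m≤n⇒m≤1+n) (λ i → f∉ i ∘ m≤n⇒m≤1+n) (λ i → ff i ∘ m<n⇒m<1+n))
               (f∈ (suc d) ≤-refl) (f∉ (suc d) ≤-refl) (ff d ≤-refl)

  Reach-along-tail : ∀ {X S} {h : ℕ → V} → (∀ i → Sub.inV X (h i)) → (∀ i → Sub.adj X (h i) (h (suc i)))
    → ∀ k → (∀ i → h (k + i) ∉ S) → ∀ d → Reach G X S (h k) (h (d + k))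
  Reach-along-tail {S = S} {h} h∈ hh k h∉ d =
    Reach-prefix (λ i → h (i + k)) d (λ i _ → h∈ (i + k))
      (λ i _ → subst (λ j → h j ∉ S) (+-comm k i) (h∉ i)) (λ i _ → hh (i + k))

  Equiv-sym : ∀ {X f g} → (∀ {x y} → Sub.adj X x y → Sub.adj X y x) → Equiv G X f g → Equiv G X g f
  Equiv-sym sym f≈g S with n , m , f∉ , g∉ , fn→gm ← f≈g S = m , n , g∉ , f∉ , Reach-reverse sym fn→gm

  Equiv-trans : ∀ {X f h g} → (∀ {x y} → Sub.adj X x y → Sub.adj X y x)
    → (∀ i → Sub.inV X (h i)) → (∀ i → Sub.adj X (h i) (h (suc i)))
    → Equiv G X f h → Equiv G X h g → Equiv G X f g
  Equiv-trans {X} {h = h} sym h∈ hh f≈h h≈g S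
    with n , m , f∉ , h∉ , fn→hm ← f≈h S | m′ , n′ , h∉′ , g∉ , hm′→gn′ ← h≈g S =
    n , n′ , f∉ , g∉ ,
    (fn→hm ++ subst (Reach G X S (h m)) (cong h (+-comm m′ m)) (Reach-along-tail h∈ hh m h∉ m′)
           ++ Reach-reverse sym (Reach-along-tail h∈ hh m′ h∉′ m) ++ hm′→gn′)

  Walk : Sub G → V → V → ℕ → Set
  Walk X u v L = Σ (ℕ → V) λ w → w 0 ≡ u × w L ≡ v × (∀ i → i < L → Sub.adj X (w i) (w (suc i)))

  Reach⇒Walk : ∀ {X S u v} → Reach G X S u v → ∃[ L ] Walk X u v L
  Reach⇒Walk {u = u} (here _ _) = 0 , (λ _ → u) , refl , refl , λ _ ()
  Reach⇒Walk {X} {u = u} (step _ _ uu′ r) with L , w , w0 , wL , ww ← Reach⇒Walk r =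
    suc L , w′ , refl , wL , w′w′
    where
    w′ : ℕ → V
    w′ zero    = u
    w′ (suc i) = w i
    w′w′ : ∀ i → i < suc L → Sub.adj X (w′ i) (w′ (suc i))
    w′w′ zero    _         = subst (Sub.adj X u) (sym w0) uu′
    w′w′ (suc i) (s≤s i<L) = ww i i<L

  splice : ℕ → (ℕ → V) → (ℕ → V) → ℕ → V
  splice zero    f h k       = h k
  splice (suc i) f h zero    = f zero
  splice (suc i) f h (suc k) = splice i (f ∘ suc) h k

  splice-start : ∀ i f h → h 0 ≡ f i → splice i f h 0 ≡ f 0
  splice-start zero    f h h0≡fi = h0≡fi
  splice-start (suc i) f h _     = refl

  splice-end : ∀ i r f h → splice i f h (i + r) ≡ h r
  splice-end zero    r f h = refl
  splice-end (suc i) r f h = splice-end i r (f ∘ suc) h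

  splice-adj : ∀ {X : Sub G} i r f h → h 0 ≡ f i
    → (∀ k → k < i → Sub.adj X (f k) (f (suc k)))
    → (∀ k → k < r → Sub.adj X (h k) (h (suc k)))
    → ∀ k → k < i + r → Sub.adj X (splice i f h k) (splice i f h (suc k))
  splice-adj zero r f h _ _ hh k k<r = hh k k<r
  splice-adj {X} (suc i) r f h h0≡fi ff hh zero _ =
    subst (Sub.adj X (f 0)) (sym (splice-start i (f ∘ suc) h h0≡fi)) (ff 0 (s≤s z≤n))
  splice-adj {X} (suc i) r f h h0≡fi ff hh (suc k) (s≤s k<i+r) =
    splice-adj {X} i r (f ∘ suc) h h0≡fi (λ k′ k′<i → ff (suc k′) (s≤s k′<i)) hh k k<i+r

  Repeats : ℕ → (ℕ → V) → Set
  Repeats L w = ∃[ i ] ∃[ d ] ∃[ r ] L ≡ i + suc d + r × w i ≡ w (i + suc d)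

  Repeats-of-collision : ∀ {L w i j} → i < j → j ≤ L → w i ≡ w j → Repeats L w
  Repeats-of-collision {L} {w} {i} {j} i<j j≤L wi≡wj
    with d , i+1+d≡j ← m≤n⇒∃[o]m+o≡n i<j | r , j+r≡L ← m≤n⇒∃[o]m+o≡n j≤L =
    i , d , r , trans (sym j+r≡L) (cong (_+ r) (sym j≡)) , trans wi≡wj (cong w (sym j≡))
    where
    j≡ : i + suc d ≡ j
    j≡ = trans (+-suc i d) i+1+d≡j

  Walk-shortcut : ∀ {X u v L} (W : Walk X u v L) → Repeats L (proj₁ W) → ∃[ L′ ] L′ < L × Walk X u v L′
  Walk-shortcut {X} {L = L} (w , w0 , wL , ww) (i , d , r , L≡ , wi≡wj) =
    i + r , shorter , splice i w h , trans (splice-start i w h h0) w0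
          , trans (splice-end i r w h) (trans (cong w (sym L≡)) wL) , splice-adj {X} i r w h h0 ww-prefix hh
    where
    j = i + suc d
    h : ℕ → V
    h t = w (j + t)
    h0 : h 0 ≡ w i
    h0 = trans (cong w (+-identityʳ j)) (sym wi≡wj)
    shorter : i + r < L
    shorter = subst (i + r <_) (sym (trans L≡ (+-assoc i (suc d) r))) (+-monoʳ-< i (s≤s (m≤n+m r d)))
    ww-prefix : ∀ k → k < i → Sub.adj X (w k) (w (suc k))
    ww-prefix k k<i = ww k (<-≤-trans k<i (subst (i ≤_) (sym L≡) (≤-trans (m≤m+n i (suc d)) (m≤m+n j r))))
    hh : ∀ k → k < r → Sub.adj X (h k) (h (suc k))
    hh k k<r = subst (λ t → Sub.adj X (h k) (w t)) (sym (+-suc j k))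
      (ww (j + k) (subst (j + k <_) (sym L≡) (+-monoʳ-< j k<r)))

  -- A repetition-free walk from b to a avoiding the edge ab closes, with ab, a cycle of the tree.
  simple-walk-closes-cycle : ∀ {TE a b L} → ¬ HasCycle G (spanning G TE) → TE a b → a ≢ b
    → (W : Walk (minusEdge G TE a b) b a L) → ¬ Repeats L (proj₁ W) → ⊥
  simple-walk-closes-cycle {L = zero}     _ _ a≢b (w , w0 , wL , _)  _ = a≢b (trans (sym wL) w0)
  simple-walk-closes-cycle {L = suc zero} _ _ _   (w , w0 , wL , ww) _ = proj₂ (ww 0 (s≤s z≤n)) (inj₂ (w0 , wL))
  simple-walk-closes-cycle {TE} {L = suc (suc L)} acyclic ab _ (w , w0 , wL , ww) simple =
    acyclic (3 + L , w , s≤s (s≤s (s≤s z≤n)) , (λ _ _ → tt) , injective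
            , (λ i i<n → proj₁ (ww i (≤-pred i<n))) , subst₂ TE (sym wL) (sym w0) ab)
    where
    injective : ∀ i j → i < 3 + L → j < 3 + L → w i ≡ w j → i ≡ j
    injective i j (s≤s i≤) (s≤s j≤) wi≡wj with <-cmp i j
    ... | tri< i<j _ _ = ⊥-elim (simple (Repeats-of-collision i<j j≤ wi≡wj))
    ... | tri≈ _ i≡j _ = i≡j
    ... | tri> _ _ j<i = ⊥-elim (simple (Repeats-of-collision j<i i≤ (sym wi≡wj)))

  tree-edge-separates : ∀ {TE a b S} → ¬ HasCycle G (spanning G TE) → TE a b → a ≢ b
    → ¬ Reach G (minusEdge G TE a b) S b a
  tree-edge-separates {TE} {a} {b} acyclic ab a≢b b→a =
    <-rec (λ L → ¬ Walk T-ab b a L) shortest _ (proj₂ (Reach⇒Walk b→a))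
    where
    T-ab = minusEdge G TE a b
    shortest : ∀ L → (∀ {L′} → L′ < L → ¬ Walk T-ab b a L′) → ¬ Walk T-ab b a L
    shortest L shorter W = ¬¬-excluded-middle λ
      { (yes repeats) → let L′ , L′<L , W′ = Walk-shortcut {X = T-ab} W repeats in shorter L′<L W′
      ; (no simple)   → simple-walk-closes-cycle acyclic ab a≢b W simple }

  no-injective-sequence-in-FiniteComponent : ∀ {X : Sub G} (f : ℕ → V) → (∀ i j → f i ≡ f j → i ≡ j)
    → FiniteComponent G X (f 0) → ¬ (∀ t → Reach G X [] (f 0) (f t))
  no-injective-sequence-in-FiniteComponent f f-inj (C , C-covers) f0→f
    with i , j , i<j , same ← pigeonhole-∈ (f ∘ toℕ) (n<1+n (length C)) (λ i → C-covers _ (f0→f (toℕ i))) =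
    Finₚ.<⇒≢ i<j (Finₚ.toℕ-injective (f-inj _ _ same))

  F-edge-beyond : ∀ {TE F} {g : ℕ → V} → IsRay G (spanning G TE) g
    → (∀ v → FiniteComponent G (minusEdges G TE F) v)
    → ∀ N → ¬ ¬ (∃[ p ] N ≤ p × F (g p) (g (suc p)))
  F-edge-beyond {g = g} (_ , gg , g-inj) finite N no-F-edge =
    no-injective-sequence-in-FiniteComponent (λ t → g (t + N))
      (λ i j same → +-cancelʳ-≡ N i j (g-inj _ _ same)) (finite (g N))
      (λ t → Reach-prefix _ t (λ _ _ → tt) (λ _ _ ())
               λ i _ → gg (i + N) , λ F-edge → no-F-edge (i + N , m≤n+m N i , F-edge))

module TreeEdge {G : Graph} {TE : Graph.V G → Graph.V G → Set} (tree : SpanningTree G TE)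
                {a b : Graph.V G} (ab : TE a b) where
  open Graph G

  private
    T-ab : Sub G
    T-ab = minusEdge G TE a b

  Side : V → V → Set
  Side c x = Reach G T-ab [] c x

  Is-ab : V → V → Set
  Is-ab u v = (u ≡ a × v ≡ b) ⊎ (u ≡ b × v ≡ a)

  T-ab-sym : ∀ {x y} → Sub.adj T-ab x y → Sub.adj T-ab y x
  T-ab-sym (xy , not-ab) = proj₁ (proj₂ tree) _ _ xy , λ
    { (inj₁ (y≡a , x≡b)) → not-ab (inj₂ (x≡b , y≡a))
    ; (inj₂ (y≡b , x≡a)) → not-ab (inj₁ (x≡a , y≡b)) }

  sides-disjoint : ∀ {x} → Side a x → Side b x → ⊥
  sides-disjoint a→x b→x =
    tree-edge-separates (proj₂ (proj₂ (proj₂ tree))) ab a≢b (b→x ++ Reach-reverse T-ab-sym a→x)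
    where
    a≢b : a ≢ b
    a≢b a≡b = ~-irr (subst (a ~_) (sym a≡b) (proj₁ tree a b ab))

  side-dichotomy : ∀ v → ¬ ¬ (Side a v ⊎ Side b v)
  side-dichotomy v = extend (proj₁ (proj₂ (proj₂ tree)) a v) (inj₁ (here tt λ ()))
    where
    extend : ∀ {u w} → Reach G (spanning G TE) [] u w → Side a u ⊎ Side b u → ¬ ¬ (Side a w ⊎ Side b w)
    extend (here _ _) side k = k side
    extend (step {u} {u′} _ _ uu′ r) side k = ¬¬-excluded-middle {A = Is-ab u u′} λ
      { (yes (inj₁ (_ , u′≡b))) → extend r (inj₂ (subst (Side b) (sym u′≡b) (here tt λ ()))) k
      ; (yes (inj₂ (_ , u′≡a))) → extend r (inj₁ (subst (Side a) (sym u′≡a) (here tt λ ()))) k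
      ; (no not-ab) → extend r (⊎-map (grow not-ab) (grow not-ab) side) k }
      where
      grow : ∀ {c} → ¬ Is-ab u u′ → Side c u → Side c u′
      grow not-ab c→u = Reach-snoc c→u tt (λ ()) (uu′ , not-ab)

  -- Deleting the a-side ends of the crossing edges leaves no edge of G between the sides.
  module _ {L : List (V × V)} (crossing : ∀ x y → x ~ y → Side a x → Side b y → (x , y) ∈ L) where

    ¬Side-backward : ∀ {u w} → Reach G (whole G) (map proj₁ L) u w → ¬ Side a w → ¬ Side a u
    ¬Side-backward (here _ _)       ¬a-w = ¬a-w
    ¬Side-backward (step _ u∉ uv r) ¬a-w a-u = side-dichotomy _ λ
      { (inj₁ a-v) → ¬Side-backward r ¬a-w a-v
      ; (inj₂ b-v) → u∉ (∈-map⁺ proj₁ (crossing _ _ uv a-u b-v)) }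

module AlongRay {G : Graph} {TE : Graph.V G → Graph.V G → Set} (tree : SpanningTree G TE)
                {g : ℕ → Graph.V G} (g-ray : IsRay G (spanning G TE) g) where
  open Graph G

  private
    gg : ∀ i → TE (g i) (g (suc i))
    gg = proj₁ (proj₂ g-ray)
    g-inj : ∀ i j → g i ≡ g j → i ≡ j
    g-inj = proj₂ (proj₂ g-ray)

  module Cut (p : ℕ) = TreeEdge tree (gg p)

  Near Far : ℕ → V → Set
  Near p = Cut.Side p (g p)
  Far  p = Cut.Side p (g (suc p))

  ray-edge-survives-cut : ∀ {p m} → m ≢ p → Sub.adj (minusEdge G TE (g p) (g (suc p))) (g m) (g (suc m))
  ray-edge-survives-cut {p} m≢p = gg _ , λ
    { (inj₁ (gm≡gp , _))          → m≢p (g-inj _ _ gm≡gp)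
    ; (inj₂ (gm≡gp+1 , gm+1≡gp)) →
        m+1+n≢n 1 {p} (g-inj _ _ (trans (cong (g ∘ suc) (sym (g-inj _ _ gm≡gp+1))) gm+1≡gp)) }

  ray-start-near : ∀ p → Near p (g 0)
  ray-start-near p = Reach-reverse (Cut.T-ab-sym p)
    (Reach-prefix g p (λ _ _ → tt) (λ _ _ ()) λ i i<p → ray-edge-survives-cut (<⇒≢ i<p))

  ray-tail-far : ∀ p t → Far p (g (t + suc p))
  ray-tail-far p t = Reach-prefix (λ i → g (i + suc p)) t (λ _ _ → tt) (λ _ _ ())
    λ i _ → ray-edge-survives-cut (m+1+n≢n i)

  ¬Far-near-start : ∀ {v} (r : Reach G (spanning G TE) [] v (g 0)) p → Reach-length r ≤ p → ¬ Far p v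
  ¬Far-near-start (here _ _) p _ far = Cut.sides-disjoint p (ray-start-near p) far
  ¬Far-near-start (step {v} {v′} _ _ vv′ r) p len≤p far = ¬¬-excluded-middle {A = Cut.Is-ab p v v′} λ
    { (yes (inj₁ (v≡gp , _)))  → Cut.sides-disjoint p (subst (Near p) (sym v≡gp) (here tt λ ())) far
    ; (yes (inj₂ (_ , v′≡gp))) → crossed-back p len≤p v′≡gp
    ; (no not-ab) → ¬Far-near-start r p (≤-trans (n≤1+n _) len≤p) (Reach-snoc far tt (λ ()) (vv′ , not-ab)) }
    where
    -- g p lies on the far side of the previous ray edge, and r is one step shorter.
    crossed-back : ∀ p → suc (Reach-length r) ≤ p → v′ ≡ g p → ⊥
    crossed-back (suc p′) (s≤s len≤p′) v′≡gp =
      ¬Far-near-start r p′ len≤p′ (subst (Far p′) (sym v′≡gp) (here tt λ ()))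

  module _ {p : ℕ} {L : List (V × V)} (crossing : ∀ x y → x ~ y → Near p x → Far p y → (x , y) ∈ L) where

    ray-meets-crossing-tails : ∀ {f} → IsRay G (whole G) f → Equiv G (whole G) f g
      → Near p (f 0) → ¬ ¬ (∃[ j ] f j ∈ map proj₁ L)
    ray-meets-crossing-tails {f} (_ , ff , _) f≈g near misses
      with n , m , _ , g∉ , fn→gm ← f≈g (map proj₁ L) =
      Cut.¬Side-backward p crossing f0→g-tail g-tail-not-near near
      where
      f0→g-tail : Reach G (whole G) (map proj₁ L) (f 0) (g (suc p + m))
      f0→g-tail = Reach-prefix f n (λ _ _ → tt) (λ j _ j∈ → misses (j , j∈)) (λ j _ → ff j)
               ++ fn→gm
               ++ Reach-along-tail (λ _ → tt) (λ i → proj₁ tree _ _ (gg i)) m g∉ (suc p)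
      g-tail-not-near : ¬ Near p (g (suc p + m))
      g-tail-not-near near-end = Cut.sides-disjoint p near-end
        (subst (λ t → Far p (g t)) (+-comm m (suc p)) (ray-tail-far p m))

    ray-from-near-start-meets-crossing-tails : ∀ {f} → IsRay G (whole G) f → Equiv G (whole G) f g
      → (r : Reach G (spanning G TE) [] (f 0) (g 0)) → Reach-length r ≤ p
      → ¬ ¬ (∃[ j ] f j ∈ map proj₁ L)
    ray-from-near-start-meets-crossing-tails f-ray f≈g r len≤p misses = Cut.side-dichotomy p _ λ
      { (inj₁ near) → ray-meets-crossing-tails f-ray f≈g near misses
      ; (inj₂ far)  → ¬Far-near-start r p len≤p far }

lemma3p11 : (G : Graph) → LocallyFinite G
    → (TE : Graph.V G → Graph.V G → Set) → SpanningTree G TE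
    → Faithful G (spanning G TE)
    → (F : Graph.V G → Graph.V G → Set)
    → (∀ u v → F u v → TE u v × F v u)
    → (∀ v → FiniteComponent G (minusEdges G TE F) v)
    → (k : ℕ)
    → (∀ a b → F a b → AtMostCrossing G TE a b k)
    → EndDegreesAtMost G k
lemma3p11 G _ TE tree faithful F _ finite k crossings R R-ray (Rs , Rs-rays , Rs≈R , disjoint)
  with g , g-ray , g≈R ← proj₁ faithful R R-ray =
  F-edge-beyond g-ray finite N λ { (p , N≤p , F-edge) →
    let L , |L|≤k , crossing = crossings _ _ F-edge in
    ¬¬-∀-Fin (suc k) (λ i → ray-from-near-start-meets-crossing-tails crossing
                               (Rs-rays i) (Rs≈g i) (to-g0 i) (≤-trans (N-bound i) N≤p))
      λ hits → 1+n≰n (≤-trans (disjoint-hitting-list-length Rs disjoint hits)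
                              (≤-trans (≤-reflexive (length-map proj₁ L)) |L|≤k)) }
  where
  open Graph G
  open AlongRay tree g-ray
  to-g0 : ∀ i → Reach G (spanning G TE) [] (Rs i 0) (g 0)
  to-g0 i = proj₁ (proj₂ (proj₂ tree)) _ _
  N = proj₁ (Fin-upper-bound (suc k) (Reach-length ∘ to-g0))
  N-bound : ∀ i → Reach-length (to-g0 i) ≤ N
  N-bound = proj₂ (Fin-upper-bound (suc k) (Reach-length ∘ to-g0))
  Rs≈g : ∀ i → Equiv G (whole G) (Rs i) g
  Rs≈g i = Equiv-trans ~-sym (λ _ → tt) (proj₁ (proj₂ R-ray)) (Rs≈R i) (Equiv-sym ~-sym g≈R)
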